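{- Fix a family $\{F(N)\}_{N\ge0}$ of series in $q$. For integers $a\ge 1$, $m\ge 0$ and any finite list $\underline{k}$ of nonnegative integers, \[ \mathfrak{S}(\underbrace{m,\ldots,m}_{a},m+1,\underline{k})-\mathfrak{S}(\underbrace{m,\ldots,m}_{a-1},m+1,m,\underline{k})=\mathfrak{S}(\underbrace{m+1,\ldots,m+1}_{a+1},\underline{k}), \] where $\underline{k}$ fills the arguments from position $a+2$ on.
   Context: For a finite list $(k_1,\ldots,k_b)$ of nonnegative integers, define \[ \mathfrak{S}(k_1,\ldots,k_b)=\sum_{N_1,\ldots, N_b\ge 0}\frac{q^{\sum_{i=1}^b\binom{N_i+k_i}{2}}F(N_b)}{(q;q)_{N_1}}\begin{bmatrix}N_1\\ N_2\end{bmatrix}\begin{bmatrix}N_2\\ N_3\end{bmatrix}\cdots \begin{bmatrix}N_{b-1}\\ N_b\end{bmatrix}, \] so the $i$-th argument $k_i$ is attached to the summation index $N_i$. Here $(q;q)_n=\prod_{j=1}^n(1-q^j)$ and $\begin{bmatrix} N\\ M\end{bmatrix}=\frac{(q;q)_N}{(q;q)_M(q;q)_{N-M}}$ for $0\le M\le N$, $0$ otherwise. -}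

module Defs where

open import Level using (Level)
open import Algebra.Bundles using (CommutativeRing)
open import Data.Nat using (ℕ; zero; suc; _∸_; _≟_; _≤?_)
import Data.Nat as ℕ
open import Data.Nat.Combinatorics using (_C_)
open import Data.Nat.Divisibility using (_∣?_)
open import Data.Bool using (if_then_else_)
open import Data.List using (List; []; _∷_)
open import Relation.Nullary using (does)

module QSeries {c ℓ : Level} (R : CommutativeRing c ℓ) where
  open CommutativeRing R using (Carrier; _+_; _*_; -_; 0#; 1#)

  Series : Set c
  Series = ℕ → Carrier

  sumTo : ℕ → (ℕ → Carrier) → Carrier
  sumTo zero f = f 0
  sumTo (suc n) f = sumTo n f + f (suc n)

  zeroS : Series
  zeroS _ = 0#

  oneS : Series
  oneS zero = 1#
  oneS (suc _) = 0#

  _⊖_ : Series → Series → Series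
  (f ⊖ g) n = f n + (- g n)

  _⊛_ : Series → Series → Series
  (f ⊛ g) n = sumTo n (λ i → f i * g (n ∸ i))

  qPow : ℕ → Series
  qPow e n = if does (e ≟ n) then 1# else 0#

  poch : ℕ → Series
  poch zero = oneS
  poch (suc j) = poch j ⊛ (oneS ⊖ qPow (suc j))

  -- geom j = 1/(1 - q^(j+1)) = Σ_t q^((j+1) t)
  geom : ℕ → Series
  geom j n = if does (suc j ∣? n) then 1# else 0#

  invPoch : ℕ → Series
  invPoch zero = oneS
  invPoch (suc j) = invPoch j ⊛ geom j

  qbin : ℕ → ℕ → Series
  qbin N M = if does (M ≤? N) then poch N ⊛ (invPoch M ⊛ invPoch (N ∸ M)) else zeroS

  -- Inner nested sum: for the previous index Np and remaining arguments ks,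
  --   G Np []       = F Np
  --   G Np (k ∷ ks) = Σ_{N ≥ 0} q^binom(N+k,2) [Np N] G N ks .
  -- The coefficient of q^n of this (formally convergent) sum only receives
  -- contributions from N ≤ n+1, since binom(N+k,2) ≥ binom(N,2) > n for N ≥ n+2
  -- and all other factors are power series; hence the finite sum below is
  -- exactly the coefficient of q^n of the infinite sum.
  G : (ℕ → Series) → ℕ → List ℕ → Series
  G F Np [] = F Np
  G F Np (k ∷ ks) n =
    sumTo (suc n) (λ N → (qPow ((N ℕ.+ k) C 2) ⊛ (qbin Np N ⊛ G F N ks)) n)

  -- 𝔖(k₁,…,k_b) = Σ_{N₁} q^binom(N₁+k₁,2)/(q;q)_{N₁} G N₁ (k₂,…,k_b)
  -- (the nested form of the multiple sum in the paper; same truncation argument).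
  -- The empty list (b = 0) is never used; it is set to 0 by convention.
  𝔖 : (ℕ → Series) → List ℕ → Series
  𝔖 F [] = zeroS
  𝔖 F (k ∷ ks) n =
    sumTo (suc n) (λ N → (qPow ((N ℕ.+ k) C 2) ⊛ (invPoch N ⊛ G F N ks)) n)

{-# OPTIONS --safe #-}
module Submission where

-- Both sides are nested sums Σ_N q^binom(N+k,2) w_N X_N, with outer weights w_N = 1/(q;q)_N for 𝔖
-- and w_N = [P N] for the inner sums G_P.  Two absorption identities for q-binomials drive the proof.
-- [P, M+1] (1 - q^(M+1)) = (1 - q^P) [P-1, M], and likewise (1 - q^(M+1)) / (q;q)_(M+1) = 1/(q;q)_M,
-- let the index shift N ↦ N + 1 absorb a factor (1 - q^N) inside such a sum, turning k into k + 1 and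
-- leaving (1 - q^P) outside.  [P N] (q^(N+k) - q^(P+k)) = q^(N+k) (1 - q^P) [P-1, N] gives the
-- recurrence G_P(k+1, …) - q^(P+k) G_P(k, …) = (1 - q^P) G_(P-1)(k+1, …), which settles a = 1.
-- For larger a one inducts on a: the statement for the inner sums G_N produces a factor (1 - q^N),
-- which the index shift absorbs one level up.  The sums over N are locally finite, so everything
-- is an identity of formal power series checked coefficientwise.

open import Algebra.Bundles using (CommutativeRing)
open import Algebra.Structures using (IsCommutativeRing)
open import Data.Bool using (if_then_else_)
open import Data.List using (List; _∷_; _++_; replicate)
open import Data.Nat as ℕ using (ℕ; zero; suc; _≤_; _<_; _∸_; z≤n; s≤s; less; equal; greater)
open import Data.Nat.Combinatorics using (_C_; nCk+nC[k+1]≡[n+1]C[k+1]; nC1≡n)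
open import Data.Nat.Divisibility using (_∣?_; ∣-refl; ∣m∣n⇒∣m+n; ∣m+n∣m⇒∣n; >⇒∤)
import Data.Nat.Properties as ℕP
open import Data.Product using (_,_)
open import Data.Sum using (inj₁; inj₂)
open import Function.Bundles using (mk⇔)
open import Relation.Binary.PropositionalEquality as P using (_≡_)
open import Relation.Binary.Structures using (IsEquivalence)
open import Relation.Nullary using (yes; no)
open import Relation.Nullary.Decidable using (does-⇔; dec-true; dec-false)

open import Defs

[1+n]C2≡nC2+n : ∀ n → suc n C 2 ≡ n C 2 ℕ.+ n
[1+n]C2≡nC2+n n = P.trans (P.sym (nCk+nC[k+1]≡[n+1]C[k+1] n 1))
                          (P.trans (P.cong (ℕ._+ (n C 2)) (nC1≡n n)) (ℕP.+-comm n (n C 2)))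

1+n<s⇒n<sC2 : ∀ {n s} → suc n < s → n < s C 2
1+n<s⇒n<sC2 {n} {suc t} (s≤s n<t) =
  ℕP.≤-trans n<t (ℕP.≤-trans (ℕP.m≤n+m t (t C 2)) (ℕP.≤-reflexive (P.sym ([1+n]C2≡nC2+n t))))

module FiniteSums {c ℓ} (R : CommutativeRing c ℓ) where
  open CommutativeRing R
  open QSeries R using (sumTo)
  open import Relation.Binary.Reasoning.Setoid setoid

  sumTo-cong : ∀ n {f g : ℕ → Carrier} → (∀ i → i ≤ n → f i ≈ g i) → sumTo n f ≈ sumTo n g
  sumTo-cong zero f≈g = f≈g 0 z≤n
  sumTo-cong (suc n) f≈g =
    +-cong (sumTo-cong n (λ i i≤n → f≈g i (ℕP.m≤n⇒m≤1+n i≤n))) (f≈g (suc n) ℕP.≤-refl)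

  sumTo-zero : ∀ n {f : ℕ → Carrier} → (∀ i → i ≤ n → f i ≈ 0#) → sumTo n f ≈ 0#
  sumTo-zero zero f≈0 = f≈0 0 z≤n
  sumTo-zero (suc n) f≈0 =
    trans (+-cong (sumTo-zero n (λ i i≤n → f≈0 i (ℕP.m≤n⇒m≤1+n i≤n))) (f≈0 (suc n) ℕP.≤-refl))
          (+-identityˡ 0#)

  sumTo-distrib-+ : ∀ n (f g : ℕ → Carrier) → sumTo n (λ i → f i + g i) ≈ sumTo n f + sumTo n g
  sumTo-distrib-+ zero f g = refl
  sumTo-distrib-+ (suc n) f g = trans (+-cong (sumTo-distrib-+ n f g) refl) (interchange _ _ _ _)
    where open import Algebra.Properties.CommutativeSemigroup +-commutativeSemigroup using (interchange)

  sumTo-neg : ∀ n (f : ℕ → Carrier) → sumTo n (λ i → - f i) ≈ - sumTo n f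
  sumTo-neg zero f = refl
  sumTo-neg (suc n) f = trans (+-cong (sumTo-neg n f) refl) (⁻¹-∙-comm _ _)
    where open import Algebra.Properties.AbelianGroup +-abelianGroup using (⁻¹-∙-comm)

  *-distribˡ-sumTo : ∀ n x (f : ℕ → Carrier) → x * sumTo n f ≈ sumTo n (λ i → x * f i)
  *-distribˡ-sumTo zero x f = refl
  *-distribˡ-sumTo (suc n) x f = trans (distribˡ _ _ _) (+-cong (*-distribˡ-sumTo n x f) refl)

  *-distribʳ-sumTo : ∀ n x (f : ℕ → Carrier) → sumTo n f * x ≈ sumTo n (λ i → f i * x)
  *-distribʳ-sumTo zero x f = refl
  *-distribʳ-sumTo (suc n) x f = trans (distribʳ _ _ _) (+-cong (*-distribʳ-sumTo n x f) refl)

  sumTo-unfoldˡ : ∀ n (f : ℕ → Carrier) → sumTo (suc n) f ≈ f 0 + sumTo n (λ i → f (suc i))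
  sumTo-unfoldˡ zero f = refl
  sumTo-unfoldˡ (suc n) f = trans (+-cong (sumTo-unfoldˡ n f) refl) (+-assoc _ _ _)

  sumTo-reverse : ∀ n (f : ℕ → Carrier) → sumTo n f ≈ sumTo n (λ i → f (n ∸ i))
  sumTo-reverse zero f = refl
  sumTo-reverse (suc n) f = begin
    sumTo n f + f (suc n)                   ≈⟨ +-cong (sumTo-reverse n f) refl ⟩
    sumTo n (λ i → f (n ∸ i)) + f (suc n)   ≈⟨ +-comm _ _ ⟩
    f (suc n) + sumTo n (λ i → f (n ∸ i))   ≈⟨ sumTo-unfoldˡ n (λ i → f (suc n ∸ i)) ⟨
    sumTo (suc n) (λ i → f (suc n ∸ i))     ∎

  sumTo-pad : ∀ {m} k (f : ℕ → Carrier) → m ≤ k → (∀ i → m < i → f i ≈ 0#) → sumTo k f ≈ sumTo m f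
  sumTo-pad zero f z≤n f≈0 = refl
  sumTo-pad (suc k) f m≤1+k f≈0 with ℕP.m≤n⇒m<n∨m≡n m≤1+k
  ... | inj₂ P.refl = refl
  ... | inj₁ m<1+k =
    trans (+-cong (sumTo-pad k f (ℕP.≤-pred m<1+k) f≈0) (f≈0 (suc k) m<1+k)) (+-identityʳ _)

  sumTo-comm : ∀ n m (f : ℕ → ℕ → Carrier) →
    sumTo n (λ i → sumTo m (f i)) ≈ sumTo m (λ j → sumTo n (λ i → f i j))
  sumTo-comm zero m f = refl
  sumTo-comm (suc n) m f = trans (+-cong (sumTo-comm n m f) refl) (sym (sumTo-distrib-+ m _ _))

  sumTo-triangle : ∀ n (f : ℕ → ℕ → Carrier) →
    sumTo n (λ s → sumTo s (f s)) ≈ sumTo n (λ i → sumTo (n ∸ i) (λ j → f (i ℕ.+ j) i))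
  sumTo-triangle zero f = refl
  sumTo-triangle (suc n) f = begin
    sumTo (suc n) (λ s → sumTo s (f s))
      ≈⟨ sumTo-unfoldˡ n _ ⟩
    f 0 0 + sumTo n (λ s → sumTo (suc s) (f (suc s)))
      ≈⟨ +-cong refl (sumTo-cong n (λ s _ → sumTo-unfoldˡ s (f (suc s)))) ⟩
    f 0 0 + sumTo n (λ s → f (suc s) 0 + sumTo s (λ i → f (suc s) (suc i)))
      ≈⟨ +-cong refl (sumTo-distrib-+ n _ _) ⟩
    f 0 0 + (sumTo n (λ s → f (suc s) 0) + sumTo n (λ s → sumTo s (λ i → f (suc s) (suc i))))
      ≈⟨ +-assoc _ _ _ ⟨
    (f 0 0 + sumTo n (λ s → f (suc s) 0)) + sumTo n (λ s → sumTo s (λ i → f (suc s) (suc i)))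
      ≈⟨ +-cong (sym (sumTo-unfoldˡ n _)) (sumTo-triangle n (λ s i → f (suc s) (suc i))) ⟩
    sumTo (suc n) (λ j → f j 0) + sumTo n (λ i → sumTo (n ∸ i) (λ j → f (suc i ℕ.+ j) (suc i)))
      ≈⟨ sumTo-unfoldˡ n _ ⟨
    sumTo (suc n) (λ i → sumTo (suc n ∸ i) (λ j → f (i ℕ.+ j) i)) ∎

module PowerSeriesRing {c ℓ} (R : CommutativeRing c ℓ) where
  open CommutativeRing R
  open QSeries R
  open FiniteSums R
  open import Relation.Binary.Reasoning.Setoid setoid

  -- A record rather than a Π-type, so that f and g can be inferred from a proof of f ≋ g.
  infix 4 _≋_
  record _≋_ (f g : Series) : Set ℓ where
    constructor mk≋
    field at : ∀ n → f n ≈ g n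
  open _≋_ public

  infixl 6 _⊕_
  _⊕_ : Series → Series → Series
  (f ⊕ g) n = f n + g n

  ⊝_ : Series → Series
  (⊝ f) n = - f n

  ⊛-cong : ∀ {f f′ g g′} → f ≋ f′ → g ≋ g′ → (f ⊛ g) ≋ (f′ ⊛ g′)
  ⊛-cong f≋f′ g≋g′ = mk≋ λ n → sumTo-cong n (λ i _ → *-cong (at f≋f′ i) (at g≋g′ (n ∸ i)))

  ⊛-congˡ : ∀ f {g g′} → g ≋ g′ → (f ⊛ g) ≋ (f ⊛ g′)
  ⊛-congˡ f g≋g′ = mk≋ λ n → sumTo-cong n (λ i _ → *-congˡ (at g≋g′ (n ∸ i)))

  ⊛-congʳ : ∀ g {f f′} → f ≋ f′ → (f ⊛ g) ≋ (f′ ⊛ g)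
  ⊛-congʳ g f≋f′ = mk≋ λ n → sumTo-cong n (λ i _ → *-congʳ (at f≋f′ i))

  ⊛-comm : ∀ f g → (f ⊛ g) ≋ (g ⊛ f)
  ⊛-comm f g = mk≋ λ n → trans (sumTo-reverse n _) (sumTo-cong n λ i i≤n →
    trans (*-cong refl (reflexive (P.cong g (ℕP.m∸[m∸n]≡n i≤n)))) (*-comm _ _))

  ⊛-assoc : ∀ f g h → ((f ⊛ g) ⊛ h) ≋ (f ⊛ (g ⊛ h))
  ⊛-assoc f g h = mk≋ λ n → begin
    sumTo n (λ s → sumTo s (λ i → f i * g (s ∸ i)) * h (n ∸ s))
      ≈⟨ sumTo-cong n (λ s _ → *-distribʳ-sumTo s _ _) ⟩
    sumTo n (λ s → sumTo s (λ i → f i * g (s ∸ i) * h (n ∸ s)))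
      ≈⟨ sumTo-triangle n _ ⟩
    sumTo n (λ i → sumTo (n ∸ i) (λ j → f i * g ((i ℕ.+ j) ∸ i) * h (n ∸ (i ℕ.+ j))))
      ≈⟨ sumTo-cong n (λ i _ → sumTo-cong (n ∸ i) (λ j _ →
           trans (*-cong (*-cong refl (reflexive (P.cong g (ℕP.m+n∸m≡n i j))))
                         (reflexive (P.cong h (P.sym (ℕP.∸-+-assoc n i j)))))
                 (*-assoc _ _ _))) ⟩
    sumTo n (λ i → sumTo (n ∸ i) (λ j → f i * (g j * h (n ∸ i ∸ j))))
      ≈⟨ sumTo-cong n (λ i _ → *-distribˡ-sumTo (n ∸ i) _ _) ⟨
    sumTo n (λ i → f i * sumTo (n ∸ i) (λ j → g j * h (n ∸ i ∸ j))) ∎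

  ⊛-identityˡ : ∀ f → (oneS ⊛ f) ≋ f
  ⊛-identityˡ f = mk≋ λ where
    zero → *-identityˡ _
    (suc n) → trans (sumTo-unfoldˡ n _)
      (trans (+-cong (*-identityˡ _) (sumTo-zero n (λ i _ → zeroˡ _))) (+-identityʳ _))

  ⊛-distribʳ : ∀ f g h → ((g ⊕ h) ⊛ f) ≋ ((g ⊛ f) ⊕ (h ⊛ f))
  ⊛-distribʳ f g h = mk≋ λ n → trans (sumTo-cong n (λ i _ → distribʳ _ _ _)) (sumTo-distrib-+ n _ _)

  private
    ≋-isEquivalence : IsEquivalence _≋_
    ≋-isEquivalence = record
      { refl = mk≋ λ _ → refl
      ; sym = λ f≋g → mk≋ λ n → sym (at f≋g n)
      ; trans = λ f≋g g≋h → mk≋ λ n → trans (at f≋g n) (at g≋h n)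
      }

    ⊛-identityʳ : ∀ f → (f ⊛ oneS) ≋ f
    ⊛-identityʳ f = mk≋ λ n → trans (at (⊛-comm f oneS) n) (at (⊛-identityˡ f) n)

    ⊛-distribˡ : ∀ f g h → (f ⊛ (g ⊕ h)) ≋ ((f ⊛ g) ⊕ (f ⊛ h))
    ⊛-distribˡ f g h = mk≋ λ n → trans (at (⊛-comm f (g ⊕ h)) n)
      (trans (at (⊛-distribʳ f g h) n) (+-cong (at (⊛-comm g f) n) (at (⊛-comm h f) n)))

  ⊕-⊛-isCommutativeRing : IsCommutativeRing _≋_ _⊕_ _⊛_ ⊝_ zeroS oneS
  ⊕-⊛-isCommutativeRing = record
    { isRing = record
      { +-isAbelianGroup = record
        { isGroup = record
          { isMonoid = record
            { isSemigroup = record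
              { isMagma = record
                { isEquivalence = ≋-isEquivalence
                ; ∙-cong = λ f≋f′ g≋g′ → mk≋ λ n → +-cong (at f≋f′ n) (at g≋g′ n) }
              ; assoc = λ f g h → mk≋ λ n → +-assoc _ _ _ }
            ; identity = (λ f → mk≋ λ n → +-identityˡ _) , (λ f → mk≋ λ n → +-identityʳ _) }
          ; inverse = (λ f → mk≋ λ n → -‿inverseˡ _) , (λ f → mk≋ λ n → -‿inverseʳ _)
          ; ⁻¹-cong = λ f≋g → mk≋ λ n → -‿cong (at f≋g n) }
        ; comm = λ f g → mk≋ λ n → +-comm _ _ }
      ; *-cong = ⊛-cong
      ; *-assoc = ⊛-assoc
      ; *-identity = ⊛-identityˡ , ⊛-identityʳ
      ; distrib = ⊛-distribˡ , ⊛-distribʳ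
      }
    ; *-comm = ⊛-comm
    }

  seriesRing : CommutativeRing c ℓ
  seriesRing = record { isCommutativeRing = ⊕-⊛-isCommutativeRing }

  private module S = CommutativeRing seriesRing

  f≋0⇒f⊛g≋0 : ∀ {f} g → f ≋ zeroS → (f ⊛ g) ≋ zeroS
  f≋0⇒f⊛g≋0 g f≋0 = S.trans (⊛-congʳ g f≋0) (S.zeroˡ g)

  g≋0⇒f⊛g≋0 : ∀ f {g} → g ≋ zeroS → (f ⊛ g) ≋ zeroS
  g≋0⇒f⊛g≋0 f g≋0 = S.trans (⊛-congˡ f g≋0) (S.zeroʳ f)

module Monomials {c ℓ} (R : CommutativeRing c ℓ) where
  open CommutativeRing R
  open QSeries R
  open FiniteSums R
  open PowerSeriesRing R
  private module S = CommutativeRing seriesRing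

  qPow-zero : qPow 0 ≋ oneS
  qPow-zero = mk≋ λ where
    zero → refl
    (suc n) → refl

  qPow-suc-⊛-zero : ∀ a g → (qPow (suc a) ⊛ g) 0 ≈ 0#
  qPow-suc-⊛-zero a g = zeroˡ _

  qPow-suc-⊛-suc : ∀ a g n → (qPow (suc a) ⊛ g) (suc n) ≈ (qPow a ⊛ g) n
  qPow-suc-⊛-suc a g n = trans (sumTo-unfoldˡ n _) (trans (+-cong (zeroˡ _) refl) (+-identityˡ _))

  qPow-⊛-below : ∀ a g {n} → n < a → (qPow a ⊛ g) n ≈ 0#
  qPow-⊛-below (suc a) g {zero} _ = qPow-suc-⊛-zero a g
  qPow-⊛-below (suc a) g {suc n} (s≤s n<a) = trans (qPow-suc-⊛-suc a g n) (qPow-⊛-below a g n<a)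

  qPow-⊛-shift : ∀ a g n → (qPow a ⊛ g) (a ℕ.+ n) ≈ g n
  qPow-⊛-shift zero g n = at (S.trans (⊛-congʳ g qPow-zero) (S.*-identityˡ g)) n
  qPow-⊛-shift (suc a) g n = trans (qPow-suc-⊛-suc a g (a ℕ.+ n)) (qPow-⊛-shift a g n)

  qPow-+ : ∀ a b → (qPow a ⊛ qPow b) ≋ qPow (a ℕ.+ b)
  qPow-+ zero b = S.trans (⊛-congʳ (qPow b) qPow-zero) (S.*-identityˡ (qPow b))
  qPow-+ (suc a) b = mk≋ λ where
    zero → qPow-suc-⊛-zero a (qPow b)
    (suc n) → trans (qPow-suc-⊛-suc a (qPow b) n) (at (qPow-+ a b) n)

  -- poch (suc j) unfolds to poch j ⊛ 1-q^ (suc j).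
  1-q^ : ℕ → Series
  1-q^ e = oneS ⊖ qPow e

  1-q^0 : 1-q^ 0 ≋ zeroS
  1-q^0 = mk≋ λ where
    zero → -‿inverseʳ 1#
    (suc n) → -‿inverseʳ 0#

  geom-periodic : ∀ j t → geom j (suc j ℕ.+ t) ≡ geom j t
  geom-periodic j t = P.cong (λ b → if b then 1# else 0#)
    (does-⇔ (mk⇔ (λ d → ∣m+n∣m⇒∣n d ∣-refl) (∣m∣n⇒∣m+n ∣-refl))
            (suc j ∣? (suc j ℕ.+ t)) (suc j ∣? t))

  geom-⊛-1-q^ : ∀ j → (geom j ⊛ 1-q^ (suc j)) ≋ oneS
  geom-⊛-1-q^ j = begin
    geom j ⊛ (oneS ⊖ qPow (suc j))
      ≈⟨ x[y-z]≈xy-xz (geom j) oneS (qPow (suc j)) ⟩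
    (geom j ⊛ oneS) ⊖ (geom j ⊛ qPow (suc j))
      ≈⟨ S.+-cong (S.*-identityʳ (geom j)) (S.-‿cong (S.*-comm (geom j) (qPow (suc j)))) ⟩
    geom j ⊖ (qPow (suc j) ⊛ geom j)
      ≈⟨ mk≋ coefficient ⟩
    oneS ∎
    where
    open import Algebra.Properties.Ring S.ring using (x[y-z]≈xy-xz)
    open import Relation.Binary.Reasoning.Setoid S.setoid

    x-0≈x : ∀ {x} → x + - 0# ≈ x
    x-0≈x = trans (+-congˡ (-0#≈0# ring)) (+-identityʳ _)
      where open import Algebra.Properties.Ring using (-0#≈0#)

    coefficient : ∀ n → geom j n + - (qPow (suc j) ⊛ geom j) n ≈ oneS n
    coefficient zero = trans (+-congˡ (-‿cong (qPow-suc-⊛-zero j (geom j)))) x-0≈x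
    coefficient (suc n) with suc j ℕ.≤? suc n
    ... | yes j<1+n with ℕP.m≤n⇒∃[o]m+o≡n j<1+n
    ...   | t , P.refl =
      trans (+-cong (reflexive (geom-periodic j t)) (-‿cong (qPow-⊛-shift (suc j) (geom j) t))) (-‿inverseʳ _)
    coefficient (suc n) | no j≮1+n =
      trans (+-cong (reflexive geom≡0) (-‿cong (qPow-⊛-below (suc j) (geom j) 1+n<1+j))) x-0≈x
      where
      1+n<1+j : suc n < suc j
      1+n<1+j = ℕP.≰⇒> j≮1+n
      geom≡0 : geom j (suc n) ≡ 0#
      geom≡0 = P.cong (λ b → if b then 1# else 0#) (dec-false (suc j ∣? suc n) (>⇒∤ 1+n<1+j))

module LocallyFiniteSums {c ℓ} (R : CommutativeRing c ℓ) where
  open CommutativeRing R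
  open QSeries R
  open FiniteSums R
  open PowerSeriesRing R
  open import Relation.Binary.Reasoning.Setoid setoid

  -- The coefficient of q^n only sums N ≤ n + 1; this is the whole sum for locally finite families.
  sumFamily : (ℕ → Series) → Series
  sumFamily f n = sumTo (suc n) (λ N → f N n)

  LocallyFinite : (ℕ → Series) → Set ℓ
  LocallyFinite f = ∀ N n → suc n < N → f N n ≈ 0#

  sumFamily-cong : ∀ {f g : ℕ → Series} → (∀ N → f N ≋ g N) → sumFamily f ≋ sumFamily g
  sumFamily-cong f≋g = mk≋ λ n → sumTo-cong (suc n) (λ N _ → at (f≋g N) n)

  sumFamily-⊖ : ∀ (f g : ℕ → Series) → (sumFamily f ⊖ sumFamily g) ≋ sumFamily (λ N → f N ⊖ g N)
  sumFamily-⊖ f g = mk≋ λ n →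
    sym (trans (sumTo-distrib-+ (suc n) _ _) (+-congˡ (sumTo-neg (suc n) _)))

  *-distribˡ-sumFamily : ∀ a f → LocallyFinite f → (a ⊛ sumFamily f) ≋ sumFamily (λ N → a ⊛ f N)
  *-distribˡ-sumFamily a f f-finite = mk≋ λ n → begin
    sumTo n (λ i → a i * sumTo (suc (n ∸ i)) (λ N → f N (n ∸ i)))
      ≈⟨ sumTo-cong n (λ i _ → *-congˡ (sym
           (sumTo-pad (suc n) _ (s≤s (ℕP.m∸n≤m n i)) (λ N → f-finite N (n ∸ i))))) ⟩
    sumTo n (λ i → a i * sumTo (suc n) (λ N → f N (n ∸ i)))
      ≈⟨ sumTo-cong n (λ i _ → *-distribˡ-sumTo (suc n) _ _) ⟩
    sumTo n (λ i → sumTo (suc n) (λ N → a i * f N (n ∸ i)))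
      ≈⟨ sumTo-comm n (suc n) _ ⟩
    sumTo (suc n) (λ N → sumTo n (λ i → a i * f N (n ∸ i))) ∎

  sumFamily-shift : ∀ f → f 0 ≋ zeroS → LocallyFinite f → sumFamily f ≋ sumFamily (λ N → f (suc N))
  sumFamily-shift f f₀≋0 f-finite = mk≋ λ n → begin
    sumTo (suc n) (λ N → f N n)
      ≈⟨ sumTo-unfoldˡ n _ ⟩
    f 0 n + sumTo n (λ N → f (suc N) n)
      ≈⟨ trans (+-congʳ (at f₀≋0 n)) (+-identityˡ _) ⟩
    sumTo n (λ N → f (suc N) n)
      ≈⟨ sumTo-pad (suc n) _ (ℕP.n≤1+n n) (λ N n<N → f-finite (suc N) n (s≤s n<N)) ⟨
    sumTo (suc n) (λ N → f (suc N) n) ∎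

module QBinomials {c ℓ} (R : CommutativeRing c ℓ) where
  open QSeries R
  open PowerSeriesRing R
  open Monomials R
  open CommutativeRing seriesRing
  open import Algebra.Properties.Ring ring using (x[y-z]≈xy-xz)
  open import Relation.Binary.Reasoning.Setoid setoid
  open import Algebra.Solver.CommutativeMonoid *-commutativeMonoid using (solve; _⊜_) renaming (_⊕_ to _·_)

  qPow-⊛-1-q^ : ∀ a b → (qPow a ⊛ 1-q^ b) ≋ (qPow a ⊖ qPow (a ℕ.+ b))
  qPow-⊛-1-q^ a b =
    trans (x[y-z]≈xy-xz (qPow a) oneS (qPow b)) (+-cong (*-identityʳ (qPow a)) (-‿cong (qPow-+ a b)))

  invPoch-⊛-1-q^ : ∀ j → (invPoch (suc j) ⊛ 1-q^ (suc j)) ≋ invPoch j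
  invPoch-⊛-1-q^ j = begin
    (invPoch j ⊛ geom j) ⊛ 1-q^ (suc j)  ≈⟨ *-assoc (invPoch j) (geom j) (1-q^ (suc j)) ⟩
    invPoch j ⊛ (geom j ⊛ 1-q^ (suc j))  ≈⟨ ⊛-congˡ (invPoch j) (geom-⊛-1-q^ j) ⟩
    invPoch j ⊛ oneS                     ≈⟨ *-identityʳ (invPoch j) ⟩
    invPoch j                            ∎

  qbin-+ : ∀ M d {P} → M ℕ.+ d ≡ P → qbin P M ≋ (poch P ⊛ (invPoch M ⊛ invPoch d))
  qbin-+ M d P.refl rewrite dec-true (M ℕ.≤? M ℕ.+ d) (ℕP.m≤m+n M d) | ℕP.m+n∸m≡n M d = refl

  qbin-> : ∀ {P M} → P < M → qbin P M ≋ zeroS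
  qbin-> {P} {M} P<M rewrite dec-false (M ℕ.≤? P) (ℕP.<⇒≱ P<M) = refl

  qbin-absorbˡ : ∀ P M → (qbin P (suc M) ⊛ 1-q^ (suc M)) ≋ (1-q^ P ⊛ qbin (P ∸ 1) M)
  qbin-absorbˡ zero M = trans (f≋0⇒f⊛g≋0 (1-q^ (suc M)) (qbin-> {0} {suc M} (s≤s z≤n)))
                              (sym (f≋0⇒f⊛g≋0 (qbin 0 M) 1-q^0))
  qbin-absorbˡ (suc P) M with M ℕ.≤? P
  ... | no M≰P = trans (f≋0⇒f⊛g≋0 (1-q^ (suc M)) (qbin-> (s≤s (ℕP.≰⇒> M≰P))))
                       (sym (g≋0⇒f⊛g≋0 (1-q^ (suc P)) (qbin-> (ℕP.≰⇒> M≰P))))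
  ... | yes M≤P with ℕP.m≤n⇒∃[o]m+o≡n M≤P
  ...   | d , P.refl = begin
    qbin (suc (M ℕ.+ d)) (suc M) ⊛ 1-q^ (suc M)
      ≈⟨ ⊛-congʳ (1-q^ (suc M)) (qbin-+ (suc M) d P.refl) ⟩
    ((poch (M ℕ.+ d) ⊛ 1-q^ (suc (M ℕ.+ d))) ⊛ (invPoch (suc M) ⊛ invPoch d)) ⊛ 1-q^ (suc M)
      ≈⟨ solve 5 (λ p u i₁ i u₁ → ((p · u) · (i₁ · i)) · u₁ ⊜ u · (p · ((i₁ · u₁) · i))) refl
           (poch (M ℕ.+ d)) (1-q^ (suc (M ℕ.+ d))) (invPoch (suc M)) (invPoch d) (1-q^ (suc M)) ⟩
    1-q^ (suc (M ℕ.+ d)) ⊛ (poch (M ℕ.+ d) ⊛ ((invPoch (suc M) ⊛ 1-q^ (suc M)) ⊛ invPoch d))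
      ≈⟨ ⊛-congˡ (1-q^ (suc (M ℕ.+ d)))
           (⊛-congˡ (poch (M ℕ.+ d)) (⊛-congʳ (invPoch d) (invPoch-⊛-1-q^ M))) ⟩
    1-q^ (suc (M ℕ.+ d)) ⊛ (poch (M ℕ.+ d) ⊛ (invPoch M ⊛ invPoch d))
      ≈⟨ ⊛-congˡ (1-q^ (suc (M ℕ.+ d))) (qbin-+ M d P.refl) ⟨
    1-q^ (suc (M ℕ.+ d)) ⊛ qbin (M ℕ.+ d) M ∎

  qbin-absorbʳ : ∀ P N k →
    (qbin P N ⊛ (qPow (N ℕ.+ k) ⊖ qPow (P ℕ.+ k))) ≋ (qPow (N ℕ.+ k) ⊛ (1-q^ P ⊛ qbin (P ∸ 1) N))
  qbin-absorbʳ P N k with ℕ.compare N P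
  ... | less N d = begin
    qbin (suc D) N ⊛ (qᴺ⁺ᵏ ⊖ qPow (suc D ℕ.+ k))
      ≈⟨ ⊛-cong (qbin-+ N (suc d) (ℕP.+-suc N d)) (sym (trans (qPow-⊛-1-q^ (N ℕ.+ k) (suc d)) exponent)) ⟩
    ((poch D ⊛ 1-q^ (suc D)) ⊛ (invPoch N ⊛ invPoch (suc d))) ⊛ (qᴺ⁺ᵏ ⊛ 1-q^ (suc d))
      ≈⟨ solve 6 (λ p u i i₁ q u₁ → ((p · u) · (i · i₁)) · (q · u₁) ⊜ q · (u · (p · (i · (i₁ · u₁)))))
           refl
           (poch D) (1-q^ (suc D)) (invPoch N) (invPoch (suc d)) qᴺ⁺ᵏ (1-q^ (suc d)) ⟩
    qᴺ⁺ᵏ ⊛ (1-q^ (suc D) ⊛ (poch D ⊛ (invPoch N ⊛ (invPoch (suc d) ⊛ 1-q^ (suc d)))))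
      ≈⟨ ⊛-congˡ qᴺ⁺ᵏ (⊛-congˡ (1-q^ (suc D))
           (⊛-congˡ (poch D) (⊛-congˡ (invPoch N) (invPoch-⊛-1-q^ d)))) ⟩
    qᴺ⁺ᵏ ⊛ (1-q^ (suc D) ⊛ (poch D ⊛ (invPoch N ⊛ invPoch d)))
      ≈⟨ ⊛-congˡ qᴺ⁺ᵏ (⊛-congˡ (1-q^ (suc D)) (qbin-+ N d P.refl)) ⟨
    qᴺ⁺ᵏ ⊛ (1-q^ (suc D) ⊛ qbin D N) ∎
    where
    D : ℕ
    D = N ℕ.+ d
    qᴺ⁺ᵏ : Series
    qᴺ⁺ᵏ = qPow (N ℕ.+ k)
    exponent : (qᴺ⁺ᵏ ⊖ qPow ((N ℕ.+ k) ℕ.+ suc d)) ≋ (qᴺ⁺ᵏ ⊖ qPow (suc D ℕ.+ k))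
    exponent = +-congˡ (-‿cong (reflexive (P.cong qPow
      (P.trans (xy∙z≈xz∙y N k (suc d)) (P.cong (ℕ._+ k) (ℕP.+-suc N d))))))
      where open import Algebra.Properties.CommutativeSemigroup ℕP.+-commutativeSemigroup using (xy∙z≈xz∙y)
  ... | equal N = trans (g≋0⇒f⊛g≋0 (qbin N N) (-‿inverseʳ (qPow (N ℕ.+ k))))
                        (sym (g≋0⇒f⊛g≋0 (qPow (N ℕ.+ k)) (vanishes N)))
    where
    vanishes : ∀ N → (1-q^ N ⊛ qbin (N ∸ 1) N) ≋ zeroS
    vanishes zero = f≋0⇒f⊛g≋0 (qbin 0 0) 1-q^0
    vanishes (suc N) = g≋0⇒f⊛g≋0 (1-q^ (suc N)) (qbin-> (ℕP.n<1+n N))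
  ... | greater P e = trans (f≋0⇒f⊛g≋0 (qPow (N ℕ.+ k) ⊖ qPow (P ℕ.+ k)) (qbin-> P<N))
                            (sym (g≋0⇒f⊛g≋0 (qPow (N ℕ.+ k)) (g≋0⇒f⊛g≋0 (1-q^ P) (qbin-> P-1<N))))
    where
    P<N : P < suc (P ℕ.+ e)
    P<N = s≤s (ℕP.m≤m+n P e)
    P-1<N : P ∸ 1 < suc (P ℕ.+ e)
    P-1<N = ℕP.≤-<-trans (ℕP.m∸n≤m P 1) P<N

module WeightedSums {c ℓ} (R : CommutativeRing c ℓ) where
  open QSeries R
  open PowerSeriesRing R
  open Monomials R
  open LocallyFiniteSums R
  open QBinomials R
  open CommutativeRing seriesRing
  open import Algebra.Properties.Ring ring using (x[y-z]≈xy-xz; [y-z]x≈yx-zx)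
  open import Relation.Binary.Reasoning.Setoid setoid
  open import Algebra.Solver.CommutativeMonoid *-commutativeMonoid using (solve; _⊜_) renaming (_⊕_ to _·_)

  qTri : ℕ → ℕ → Series
  qTri k N = qPow ((N ℕ.+ k) C 2)

  qTri-suc : ∀ k N → qTri (suc k) N ≋ (qTri k N ⊛ qPow (N ℕ.+ k))
  qTri-suc k N =
    trans (reflexive (P.cong qPow (P.trans (P.cong (_C 2) (ℕP.+-suc N k)) ([1+n]C2≡nC2+n (N ℕ.+ k)))))
          (sym (qPow-+ ((N ℕ.+ k) C 2) (N ℕ.+ k)))

  qTri-locallyFinite : ∀ k (h : ℕ → Series) → LocallyFinite (λ N → qTri k N ⊛ h N)
  qTri-locallyFinite k h N n 1+n<N =
    qPow-⊛-below ((N ℕ.+ k) C 2) (h N) (1+n<s⇒n<sC2 (ℕP.≤-trans 1+n<N (ℕP.m≤m+n N k)))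

  weightedSum : (ℕ → Series) → ℕ → (ℕ → Series) → Series
  weightedSum w k X = sumFamily (λ N → qTri k N ⊛ (w N ⊛ X N))

  weightedSum-cong : ∀ w k {X Y : ℕ → Series} → (∀ N → X N ≋ Y N) → weightedSum w k X ≋ weightedSum w k Y
  weightedSum-cong w k X≋Y = sumFamily-cong λ N → ⊛-congˡ (qTri k N) (⊛-congˡ (w N) (X≋Y N))

  weightedSum-⊖ : ∀ w k X Y → (weightedSum w k X ⊖ weightedSum w k Y) ≋ weightedSum w k (λ N → X N ⊖ Y N)
  weightedSum-⊖ w k X Y = trans (sumFamily-⊖ _ _) (sumFamily-cong λ N → sym (begin
    qTri k N ⊛ (w N ⊛ (X N ⊖ Y N))
      ≈⟨ ⊛-congˡ (qTri k N) (x[y-z]≈xy-xz (w N) (X N) (Y N)) ⟩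
    qTri k N ⊛ ((w N ⊛ X N) ⊖ (w N ⊛ Y N))
      ≈⟨ x[y-z]≈xy-xz (qTri k N) (w N ⊛ X N) (w N ⊛ Y N) ⟩
    (qTri k N ⊛ (w N ⊛ X N)) ⊖ (qTri k N ⊛ (w N ⊛ Y N)) ∎))

  *-distribˡ-weightedSum : ∀ a w k X → (a ⊛ weightedSum w k X) ≋ weightedSum w k (λ N → a ⊛ X N)
  *-distribˡ-weightedSum a w k X =
    trans (*-distribˡ-sumFamily a _ (qTri-locallyFinite k (λ N → w N ⊛ X N))) (sumFamily-cong λ N →
      solve 4 (λ a t v x → a · (t · (v · x)) ⊜ t · (v · (a · x))) refl a (qTri k N) (w N) (X N))

  weightedSum-suc : ∀ w k X → weightedSum w (suc k) X ≋ weightedSum w k (λ N → qPow (N ℕ.+ k) ⊛ X N)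
  weightedSum-suc w k X = sumFamily-cong λ N → begin
    qTri (suc k) N ⊛ (w N ⊛ X N)
      ≈⟨ ⊛-congʳ (w N ⊛ X N) (qTri-suc k N) ⟩
    (qTri k N ⊛ qPow (N ℕ.+ k)) ⊛ (w N ⊛ X N)
      ≈⟨ solve 4 (λ t q v x → (t · q) · (v · x) ⊜ t · (v · (q · x))) refl
           (qTri k N) (qPow (N ℕ.+ k)) (w N) (X N) ⟩
    qTri k N ⊛ (w N ⊛ (qPow (N ℕ.+ k) ⊛ X N)) ∎

  Shifts : (ℕ → Series) → Series → (ℕ → Series) → Set ℓ
  Shifts w a w′ = ∀ M → (w (suc M) ⊛ 1-q^ (suc M)) ≋ (a ⊛ w′ M)

  invPoch-shifts : Shifts invPoch oneS invPoch
  invPoch-shifts M = trans (invPoch-⊛-1-q^ M) (sym (*-identityˡ (invPoch M)))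

  weightedSum-shift : ∀ {w a w′} → Shifts w a w′ → ∀ k X →
    weightedSum w k (λ N → 1-q^ N ⊛ X (N ∸ 1)) ≋ (a ⊛ weightedSum w′ (suc k) X)
  weightedSum-shift {w} {a} {w′} shifts k X = begin
    weightedSum w k (λ N → 1-q^ N ⊛ X (N ∸ 1))
      ≈⟨ sumFamily-shift _ vanishes (qTri-locallyFinite k (λ N → w N ⊛ (1-q^ N ⊛ X (N ∸ 1)))) ⟩
    sumFamily (λ M → qTri k (suc M) ⊛ (w (suc M) ⊛ (1-q^ (suc M) ⊛ X M)))
      ≈⟨ sumFamily-cong term ⟩
    sumFamily (λ M → a ⊛ (qTri (suc k) M ⊛ (w′ M ⊛ X M)))
      ≈⟨ *-distribˡ-sumFamily a _ (qTri-locallyFinite (suc k) (λ M → w′ M ⊛ X M)) ⟨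
    a ⊛ weightedSum w′ (suc k) X ∎
    where
    vanishes : (qTri k 0 ⊛ (w 0 ⊛ (1-q^ 0 ⊛ X 0))) ≋ zeroS
    vanishes = g≋0⇒f⊛g≋0 (qTri k 0) (g≋0⇒f⊛g≋0 (w 0) (f≋0⇒f⊛g≋0 (X 0) 1-q^0))

    term : ∀ M → (qTri k (suc M) ⊛ (w (suc M) ⊛ (1-q^ (suc M) ⊛ X M)))
                   ≋ (a ⊛ (qTri (suc k) M ⊛ (w′ M ⊛ X M)))
    term M = begin
      qTri k (suc M) ⊛ (w (suc M) ⊛ (1-q^ (suc M) ⊛ X M))
        ≈⟨ ⊛-cong (reflexive (P.cong (λ e → qPow (e C 2)) (P.sym (ℕP.+-suc M k))))
                  (sym (*-assoc (w (suc M)) (1-q^ (suc M)) (X M))) ⟩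
      qTri (suc k) M ⊛ ((w (suc M) ⊛ 1-q^ (suc M)) ⊛ X M)
        ≈⟨ ⊛-congˡ (qTri (suc k) M) (⊛-congʳ (X M) (shifts M)) ⟩
      qTri (suc k) M ⊛ ((a ⊛ w′ M) ⊛ X M)
        ≈⟨ solve 4 (λ t a v x → t · ((a · v) · x) ⊜ a · (t · (v · x))) refl
             (qTri (suc k) M) a (w′ M) (X M) ⟩
      a ⊛ (qTri (suc k) M ⊛ (w′ M ⊛ X M)) ∎

  weightedSum-qbin-recurrence : ∀ P k Y →
    (weightedSum (qbin P) (suc k) Y ⊖ (qPow (P ℕ.+ k) ⊛ weightedSum (qbin P) k Y))
      ≋ (1-q^ P ⊛ weightedSum (qbin (P ∸ 1)) (suc k) Y)
  weightedSum-qbin-recurrence P k Y = begin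
    weightedSum (qbin P) (suc k) Y ⊖ (qPow (P ℕ.+ k) ⊛ weightedSum (qbin P) k Y)
      ≈⟨ +-cong (weightedSum-suc (qbin P) k Y) (-‿cong (*-distribˡ-weightedSum (qPow (P ℕ.+ k)) (qbin P) k Y)) ⟩
    weightedSum (qbin P) k (λ N → qPow (N ℕ.+ k) ⊛ Y N) ⊖ weightedSum (qbin P) k (λ N → qPow (P ℕ.+ k) ⊛ Y N)
      ≈⟨ weightedSum-⊖ (qbin P) k (λ N → qPow (N ℕ.+ k) ⊛ Y N) (λ N → qPow (P ℕ.+ k) ⊛ Y N) ⟩
    weightedSum (qbin P) k (λ N → (qPow (N ℕ.+ k) ⊛ Y N) ⊖ (qPow (P ℕ.+ k) ⊛ Y N))
      ≈⟨ sumFamily-cong term ⟩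
    sumFamily (λ N → 1-q^ P ⊛ (qTri (suc k) N ⊛ (qbin (P ∸ 1) N ⊛ Y N)))
      ≈⟨ *-distribˡ-sumFamily (1-q^ P) _ (qTri-locallyFinite (suc k) (λ N → qbin (P ∸ 1) N ⊛ Y N)) ⟨
    1-q^ P ⊛ weightedSum (qbin (P ∸ 1)) (suc k) Y ∎
    where
    term : ∀ N → (qTri k N ⊛ (qbin P N ⊛ ((qPow (N ℕ.+ k) ⊛ Y N) ⊖ (qPow (P ℕ.+ k) ⊛ Y N))))
                   ≋ (1-q^ P ⊛ (qTri (suc k) N ⊛ (qbin (P ∸ 1) N ⊛ Y N)))
    term N = begin
      qTri k N ⊛ (qbin P N ⊛ ((qPow (N ℕ.+ k) ⊛ Y N) ⊖ (qPow (P ℕ.+ k) ⊛ Y N)))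
        ≈⟨ ⊛-congˡ (qTri k N) (⊛-congˡ (qbin P N) ([y-z]x≈yx-zx (Y N) (qPow (N ℕ.+ k)) (qPow (P ℕ.+ k)))) ⟨
      qTri k N ⊛ (qbin P N ⊛ ((qPow (N ℕ.+ k) ⊖ qPow (P ℕ.+ k)) ⊛ Y N))
        ≈⟨ ⊛-congˡ (qTri k N) (*-assoc (qbin P N) (qPow (N ℕ.+ k) ⊖ qPow (P ℕ.+ k)) (Y N)) ⟨
      qTri k N ⊛ ((qbin P N ⊛ (qPow (N ℕ.+ k) ⊖ qPow (P ℕ.+ k))) ⊛ Y N)
        ≈⟨ ⊛-congˡ (qTri k N) (⊛-congʳ (Y N) (qbin-absorbʳ P N k)) ⟩
      qTri k N ⊛ ((qPow (N ℕ.+ k) ⊛ (1-q^ P ⊛ qbin (P ∸ 1) N)) ⊛ Y N)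
        ≈⟨ solve 5 (λ t q u b y → t · ((q · (u · b)) · y) ⊜ u · ((t · q) · (b · y))) refl
             (qTri k N) (qPow (N ℕ.+ k)) (1-q^ P) (qbin (P ∸ 1) N) (Y N) ⟩
      1-q^ P ⊛ ((qTri k N ⊛ qPow (N ℕ.+ k)) ⊛ (qbin (P ∸ 1) N ⊛ Y N))
        ≈⟨ ⊛-congˡ (1-q^ P) (⊛-congʳ (qbin (P ∸ 1) N ⊛ Y N) (qTri-suc k N)) ⟨
      1-q^ P ⊛ (qTri (suc k) N ⊛ (qbin (P ∸ 1) N ⊛ Y N)) ∎

module NestedSums {c ℓ} (R : CommutativeRing c ℓ) (F : ℕ → QSeries.Series R) where
  open QSeries R
  open PowerSeriesRing R
  open Monomials R using (1-q^)
  open QBinomials R using (qbin-absorbˡ)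
  open WeightedSums R
  open CommutativeRing seriesRing
  open import Relation.Binary.Reasoning.Setoid setoid

  record IsNestedSum (S : List ℕ → Series) (w : ℕ → Series) : Set ℓ where
    field unfold : ∀ k ks → S (k ∷ ks) ≋ weightedSum w k (λ N → G F N ks)
  open IsNestedSum

  𝔖-isNestedSum : IsNestedSum (𝔖 F) invPoch
  𝔖-isNestedSum = record { unfold = λ _ _ → refl }

  G-isNestedSum : ∀ P → IsNestedSum (G F P) (qbin P)
  G-isNestedSum P = record { unfold = λ _ _ → refl }

  nestedSum-difference : ∀ m ks {S w a w′ S′} →
    IsNestedSum S w → Shifts w a w′ → IsNestedSum S′ w′ → ∀ A →
    (S (replicate (suc A) m ++ suc m ∷ ks) ⊖ S (replicate A m ++ suc m ∷ m ∷ ks))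
      ≋ (a ⊛ S′ (replicate (suc (suc A)) (suc m) ++ ks))
  nestedSum-difference m ks {S} {w} {a} {w′} {S′} S-nested shifts S′-nested zero = begin
    S (m ∷ suc m ∷ ks) ⊖ S (suc m ∷ m ∷ ks)
      ≈⟨ +-cong (unfold S-nested m (suc m ∷ ks))
                (-‿cong (trans (unfold S-nested (suc m) (m ∷ ks)) (weightedSum-suc w m (λ N → G F N (m ∷ ks))))) ⟩
    weightedSum w m (λ N → G F N (suc m ∷ ks)) ⊖ weightedSum w m (λ N → qPow (N ℕ.+ m) ⊛ G F N (m ∷ ks))
      ≈⟨ weightedSum-⊖ w m (λ N → G F N (suc m ∷ ks)) (λ N → qPow (N ℕ.+ m) ⊛ G F N (m ∷ ks)) ⟩
    weightedSum w m (λ N → G F N (suc m ∷ ks) ⊖ (qPow (N ℕ.+ m) ⊛ G F N (m ∷ ks)))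
      ≈⟨ weightedSum-cong w m (λ N → weightedSum-qbin-recurrence N m (λ N′ → G F N′ ks)) ⟩
    weightedSum w m (λ N → 1-q^ N ⊛ G F (N ∸ 1) (suc m ∷ ks))
      ≈⟨ weightedSum-shift shifts m (λ N → G F N (suc m ∷ ks)) ⟩
    a ⊛ weightedSum w′ (suc m) (λ N → G F N (suc m ∷ ks))
      ≈⟨ ⊛-congˡ a (unfold S′-nested (suc m) (suc m ∷ ks)) ⟨
    a ⊛ S′ (suc m ∷ suc m ∷ ks) ∎
  nestedSum-difference m ks {S} {w} {a} {w′} {S′} S-nested shifts S′-nested (suc A) = begin
    S (m ∷ L₁) ⊖ S (m ∷ L₂)
      ≈⟨ +-cong (unfold S-nested m L₁) (-‿cong (unfold S-nested m L₂)) ⟩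
    weightedSum w m (λ N → G F N L₁) ⊖ weightedSum w m (λ N → G F N L₂)
      ≈⟨ weightedSum-⊖ w m (λ N → G F N L₁) (λ N → G F N L₂) ⟩
    weightedSum w m (λ N → G F N L₁ ⊖ G F N L₂)
      ≈⟨ weightedSum-cong w m (λ N →
           nestedSum-difference m ks (G-isNestedSum N) (qbin-absorbˡ N) (G-isNestedSum (N ∸ 1)) A) ⟩
    weightedSum w m (λ N → 1-q^ N ⊛ G F (N ∸ 1) L₃)
      ≈⟨ weightedSum-shift shifts m (λ N → G F N L₃) ⟩
    a ⊛ weightedSum w′ (suc m) (λ N → G F N L₃)
      ≈⟨ ⊛-congˡ a (unfold S′-nested (suc m) L₃) ⟨
    a ⊛ S′ (suc m ∷ L₃) ∎
    where
    L₁ L₂ L₃ : List ℕ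
    L₁ = replicate (suc A) m ++ suc m ∷ ks
    L₂ = replicate A m ++ suc m ∷ m ∷ ks
    L₃ = replicate (suc (suc A)) (suc m) ++ ks

lemma5p10 : ∀ {c ℓ} (R : CommutativeRing c ℓ) (F : ℕ → QSeries.Series R) (a m : ℕ) → 1 ≤ a → (ks : List ℕ) → (n : ℕ) →
    CommutativeRing._≈_ R
      (QSeries._⊖_ R (QSeries.𝔖 R F (replicate a m ++ suc m ∷ ks)) (QSeries.𝔖 R F (replicate (a ∸ 1) m ++ suc m ∷ m ∷ ks)) n)
      (QSeries.𝔖 R F (replicate (suc a) (suc m) ++ ks) n)
lemma5p10 R F (suc A) m (s≤s z≤n) ks =
  at (trans (nestedSum-difference m ks 𝔖-isNestedSum invPoch-shifts 𝔖-isNestedSum A) (*-identityˡ _))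
  where
  open PowerSeriesRing R
  open WeightedSums R using (invPoch-shifts)
  open NestedSums R F
  open CommutativeRing seriesRing using (trans; *-identityˡ)
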